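{- For any typing context $\Gamma$ (in which a variable may occur with several types), any $\lambda$-term $M$ and any type $A$, the following are equivalent: (1) $\Gamma_\cap\vdash_\omega M:A$ in $\Lambda_{\cap\omega}$; (2) $\Gamma\vdash_{s\omega} M:A$ in $\Lambda_{\cap\omega}^s$; (3) $\Gamma\vdash_{\ell\omega} M:A$ in $\Lambda_{\cap\omega}^\ell$.
   Context: $\lambda$-terms: $M::=x\mid MM\mid\lambda x.M$ modulo $\alpha$-conversion; $M[x:=N]$ capture-avoiding substitution. Types: $A::=\varphi\mid\omega\mid A\to A\mid A\cap A$. A typing context is a finite set of pairs $x:A$ ($\Gamma,x:A$ denotes $\Gamma\cup\{x:A\}$; $x\notin\Gamma$ means no $x:B$ lies in $\Gamma$); in $\Lambda_{\cap\omega}$ variables are pairwise distinct, in the other two systems a variable may occur with several types. $\Gamma_\cap$ assigns to each variable of $\Gamma$ the intersection of all types it has in $\Gamma$. $\Lambda_{\cap\omega}$: (Ax) $\Gamma,x:A\vdash x:A$; ($\to$I) from $\Gamma,x:A\vdash M:B$, $x\notin\Gamma$, infer $\Gamma\vdash\lambda x.M:A\to B$; ($\to$E) from $\Gamma\vdash M:A\to B$ and $\Gamma\vdash N:A$ infer $\Gamma\vdash MN:B$; ($\cap$I) from $\Gamma\vdash M:A$, $\Gamma\vdash M:B$ infer $\Gamma\vdash M:A\cap B$; ($\cap$E) from $\Gamma\vdash M:A\cap B$ infer $\Gamma\vdash M:A$ and $\Gamma\vdash M:B$; $(\omega)$ $\Gamma\vdash M:\omega$. $\Lambda_{\cap\omega}^s$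 ($n\ge0$): (Ax) $\Gamma,x:A\vdash x:A$; $(\mathsf{Beta})^s$ from $\Gamma\vdash M[x:=N]N_1\dots N_n:A$ and $\Gamma\vdash N:B$ infer $\Gamma\vdash(\lambda x.M)NN_1\dots N_n:A$; $(\mathsf{L}\to)$ from $\Gamma\vdash N:A_1$ and $\Gamma,y:A_2\vdash yN_1\dots N_n:B$, with $y\notin FV(N_1)\cup\dots\cup FV(N_n)$, $y\notin\Gamma$, infer $\Gamma,x:A_1\to A_2\vdash xNN_1\dots N_n:B$; $(\mathsf{R}\to)$ from $\Gamma,x:A\vdash M:B$, $x\notin\Gamma$, infer $\Gamma\vdash\lambda x.M:A\to B$; $(\mathsf{L}\cap)$ from $\Gamma,x:A_1,x:A_2\vdash xN_1\dots N_n:B$ infer $\Gamma,x:A_1\cap A_2\vdash xN_1\dots N_n:B$; $(\mathsf{R}\cap)$ from $\Gamma\vdash M:A$ and $\Gamma\vdash M:B$ infer $\Gamma\vdash M:A\cap B$; $(\omega)$ $\Gamma\vdash M:\omega$. $\Lambda_{\cap\omega}^\ell$: same as $\Lambda_{\cap\omega}^s$ but with $(\mathsf{Beta})^s$ replaced by $(\mathsf{Beta})^\ell$: from $\Gamma\vdash M[x:=N]N_1\dots N_n:A$ infer $\Gamma\vdash(\lambda x.M)NN_1\dots N_n:A$. -}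

module Defs where

open import Data.Nat using (ℕ; zero; suc; _≟_)
open import Data.List using (List; []; _∷_; map)
open import Data.List.Membership.Propositional using (_∈_)
open import Data.List.Relation.Unary.All using (All)
open import Data.Product using (_×_; _,_; Σ)
open import Data.Maybe using (Maybe; just; nothing)
open import Relation.Binary.PropositionalEquality using (_≡_)
open import Relation.Nullary using (¬_; yes; no)
open import Function.Bundles using (_⇔_)

-- λ-terms modulo α-conversion: de Bruijn indices.
-- Free variables are the indices that escape all binders.

infixl 7 _·_
data Term : Set where
  var : ℕ → Term
  _·_ : Term → Term → Term
  ƛ_  : Term → Term

apps : Term → List Term → Term
apps M []       = M
apps M (N ∷ Ns) = apps (M · N) Ns

ext : (ℕ → ℕ) → ℕ → ℕ
ext ρ zero    = zero
ext ρ (suc n) = suc (ρ n)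

rename : (ℕ → ℕ) → Term → Term
rename ρ (var x) = var (ρ x)
rename ρ (M · N) = rename ρ M · rename ρ N
rename ρ (ƛ M)   = ƛ rename (ext ρ) M

exts : (ℕ → Term) → ℕ → Term
exts σ zero    = var zero
exts σ (suc n) = rename suc (σ n)

subst : (ℕ → Term) → Term → Term
subst σ (var x) = σ x
subst σ (M · N) = subst σ M · subst σ N
subst σ (ƛ M)   = ƛ subst (exts σ) M

-- M[x:=N] where x is the variable bound by the λ of  λx.M  (index 0)
_[_] : Term → Term → Term
M [ N ] = subst σ M
  where
  σ : ℕ → Term
  σ zero    = N
  σ (suc n) = var n

data _FreeIn_ : ℕ → Term → Set where
  fv-var : ∀ {x} → x FreeIn var x
  fv-l   : ∀ {x M N} → x FreeIn M → x FreeIn (M · N)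
  fv-r   : ∀ {x M N} → x FreeIn N → x FreeIn (M · N)
  fv-ƛ   : ∀ {x M} → suc x FreeIn M → x FreeIn (ƛ M)

infixr 6 _⇒_
infixr 7 _∩_
data Type : Set where
  atom : ℕ → Type
  ω    : Type
  _⇒_  : Type → Type → Type
  _∩_  : Type → Type → Type

-- Typing contexts for Λ^s and Λ^ℓ: finite sets of pairs x : A,
-- represented as lists, read up to set equality (all rules below only
-- look at membership, so derivability is invariant under ≈ᶜ).

Ctx : Set
Ctx = List (ℕ × Type)

_≈ᶜ_ : Ctx → Ctx → Set
Γ ≈ᶜ Δ = ∀ p → (p ∈ Γ) ⇔ (p ∈ Δ)

_∉ᶜ_ : ℕ → Ctx → Set
x ∉ᶜ Γ = ∀ B → ¬ ((x , B) ∈ Γ)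

shift : Ctx → Ctx
shift = map (λ { (x , A) → (suc x , A) })

-- Contexts for Λ_∩ω: variables pairwise distinct, i.e. partial functions.
FCtx : Set
FCtx = ℕ → Maybe Type

_▸_ : Type → FCtx → FCtx
(A ▸ Γ) zero    = just A
(A ▸ Γ) (suc n) = Γ n

typesOf : ℕ → Ctx → List Type
typesOf x []              = []
typesOf x ((y , A) ∷ Γ) with x ≟ y
... | yes _ = A ∷ typesOf x Γ
... | no  _ = typesOf x Γ

⋂⁺ : Type → List Type → Type
⋂⁺ A []       = A
⋂⁺ A (B ∷ Bs) = A ∩ ⋂⁺ B Bs

⋂ : List Type → Maybe Type
⋂ []       = nothing
⋂ (A ∷ As) = just (⋂⁺ A As)

_∩ᶜ : Ctx → FCtx
(Γ ∩ᶜ) x = ⋂ (typesOf x Γ)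

infix 4 _⊢ω_∶_
data _⊢ω_∶_ : FCtx → Term → Type → Set where
  ax  : ∀ {Γ x A} → Γ x ≡ just A → Γ ⊢ω var x ∶ A
  →I  : ∀ {Γ M A B} → (A ▸ Γ) ⊢ω M ∶ B → Γ ⊢ω ƛ M ∶ A ⇒ B
  →E  : ∀ {Γ M N A B} → Γ ⊢ω M ∶ A ⇒ B → Γ ⊢ω N ∶ A → Γ ⊢ω M · N ∶ B
  ∩I  : ∀ {Γ M A B} → Γ ⊢ω M ∶ A → Γ ⊢ω M ∶ B → Γ ⊢ω M ∶ A ∩ B
  ∩E₁ : ∀ {Γ M A B} → Γ ⊢ω M ∶ A ∩ B → Γ ⊢ω M ∶ A
  ∩E₂ : ∀ {Γ M A B} → Γ ⊢ω M ∶ A ∩ B → Γ ⊢ω M ∶ B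
  ω-r : ∀ {Γ M} → Γ ⊢ω M ∶ ω

infix 4 _⊢s_∶_
data _⊢s_∶_ : Ctx → Term → Type → Set where
  ax   : ∀ {Γ x A} → (x , A) ∈ Γ → Γ ⊢s var x ∶ A
  beta : ∀ {Γ M N Ns A B} →
         Γ ⊢s apps (M [ N ]) Ns ∶ A → Γ ⊢s N ∶ B →
         Γ ⊢s apps ((ƛ M) · N) Ns ∶ A
  L→   : ∀ {Δ Γ x y N Ns A₁ A₂ B} →
         Δ ≈ᶜ ((x , A₁ ⇒ A₂) ∷ Γ) →
         Γ ⊢s N ∶ A₁ →
         ((y , A₂) ∷ Γ) ⊢s apps (var y) Ns ∶ B →
         All (λ P → ¬ (y FreeIn P)) Ns → y ∉ᶜ Γ →
         Δ ⊢s apps (var x · N) Ns ∶ B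
  R→   : ∀ {Γ M A B} → ((zero , A) ∷ shift Γ) ⊢s M ∶ B → Γ ⊢s ƛ M ∶ A ⇒ B
  L∩   : ∀ {Δ Γ x Ns A₁ A₂ B} →
         Δ ≈ᶜ ((x , A₁ ∩ A₂) ∷ Γ) →
         ((x , A₁) ∷ (x , A₂) ∷ Γ) ⊢s apps (var x) Ns ∶ B →
         Δ ⊢s apps (var x) Ns ∶ B
  R∩   : ∀ {Γ M A B} → Γ ⊢s M ∶ A → Γ ⊢s M ∶ B → Γ ⊢s M ∶ A ∩ B
  ω-r  : ∀ {Γ M} → Γ ⊢s M ∶ ω

infix 4 _⊢ℓ_∶_
data _⊢ℓ_∶_ : Ctx → Term → Type → Set where
  ax   : ∀ {Γ x A} → (x , A) ∈ Γ → Γ ⊢ℓ var x ∶ A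
  beta : ∀ {Γ M N Ns A} →
         Γ ⊢ℓ apps (M [ N ]) Ns ∶ A →
         Γ ⊢ℓ apps ((ƛ M) · N) Ns ∶ A
  L→   : ∀ {Δ Γ x y N Ns A₁ A₂ B} →
         Δ ≈ᶜ ((x , A₁ ⇒ A₂) ∷ Γ) →
         Γ ⊢ℓ N ∶ A₁ →
         ((y , A₂) ∷ Γ) ⊢ℓ apps (var y) Ns ∶ B →
         All (λ P → ¬ (y FreeIn P)) Ns → y ∉ᶜ Γ →
         Δ ⊢ℓ apps (var x · N) Ns ∶ B
  R→   : ∀ {Γ M A B} → ((zero , A) ∷ shift Γ) ⊢ℓ M ∶ B → Γ ⊢ℓ ƛ M ∶ A ⇒ B
  L∩   : ∀ {Δ Γ x Ns A₁ A₂ B} →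
         Δ ≈ᶜ ((x , A₁ ∩ A₂) ∷ Γ) →
         ((x , A₁) ∷ (x , A₂) ∷ Γ) ⊢ℓ apps (var x) Ns ∶ B →
         Δ ⊢ℓ apps (var x) Ns ∶ B
  R∩   : ∀ {Γ M A B} → Γ ⊢ℓ M ∶ A → Γ ⊢ℓ M ∶ B → Γ ⊢ℓ M ∶ A ∩ B
  ω-r  : ∀ {Γ M} → Γ ⊢ℓ M ∶ ω

-- Λ^ℓ and Λ^s differ only in the typing premise of (Beta)^s, which ω always
-- satisfies. A Λ^s derivation becomes a Λ_∩ω derivation rule by rule: the left
-- rules are →E and ∩E applied to the head variable, and (Beta)^s is subject
-- expansion, which holds in Λ_∩ω because a typing of M[x:=N] factors through a
-- typing of M where x gets the intersection of the types at which the copies of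
-- N are used (ω if there are none). Conversely, of the Λ_∩ω rules only ∩E and →E
-- are missing from Λ^s. ∩E is admissible by pushing it up to the axioms; →E is
-- cut, admissible by induction on the size of the cut type together with a
-- substitution lemma for terms typed at smaller types: a cut against (R→)
-- becomes a (Beta)^s step whose contractum is typed by substitution, and
-- substituting a term for the head variable of an (L→) step produces a cut at
-- that variable's type, which is small by assumption.

module Submission where

open import Defs
open import Data.Empty using (⊥-elim)
open import Data.List using (List; []; _∷_; map; _∷ʳ_)
open import Data.List.Properties using (map-cong-local)
open import Data.List.Membership.Propositional using (_∈_)
open import Data.List.Membership.Propositional.Properties using (∈-map⁺; ∈-map⁻)
open import Data.List.Relation.Binary.Subset.Propositional using (_⊆_)
open import Data.List.Relation.Unary.All using (All; []; _∷_)
import Data.List.Relation.Unary.All as All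
open import Data.List.Relation.Unary.Any using (here; there)
open import Data.Maybe using (just)
open import Data.Nat using (ℕ; zero; suc; pred; _+_; _⊔_; _<_; _≤_; s≤s; _≟_)
open import Data.Nat.Properties using (≤-refl; ≤-trans; <⇒≱; m≤m⊔n; m≤n⊔m; pred-mono-≤; suc-injective; m≤m+n; m≤n+m; n≤1+n)
open import Data.Product using (∃; _×_; _,_; proj₁; proj₂)
open import Function using (_∘_; id)
open import Function.Bundles using (_⇔_; mk⇔; Equivalence)
open import Relation.Binary.PropositionalEquality
  using (_≡_; _≢_; refl; sym; trans; cong; cong₂; module ≡-Reasoning)
open import Relation.Nullary using (¬_; yes; no)

-- Substitution algebra

sub₀ : Term → ℕ → Term
sub₀ N zero    = N
sub₀ N (suc n) = var n

rename-cong : ∀ {ρ ρ′ : ℕ → ℕ} → (∀ x → ρ x ≡ ρ′ x) → ∀ M → rename ρ M ≡ rename ρ′ M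
rename-cong h (var x) = cong var (h x)
rename-cong h (M · N) = cong₂ _·_ (rename-cong h M) (rename-cong h N)
rename-cong h (ƛ M)   = cong ƛ_ (rename-cong (λ { zero → refl ; (suc x) → cong suc (h x) }) M)

subst-cong : ∀ {σ τ} M → (∀ x → x FreeIn M → σ x ≡ τ x) → subst σ M ≡ subst τ M
subst-cong (var x) h = h x fv-var
subst-cong (M · N) h = cong₂ _·_ (subst-cong M (λ x → h x ∘ fv-l)) (subst-cong N (λ x → h x ∘ fv-r))
subst-cong (ƛ M)   h = cong ƛ_ (subst-cong M λ { zero _ → refl ; (suc x) p → cong (rename suc) (h x (fv-ƛ p)) })

rename-rename : ∀ ρ ρ′ M → rename ρ (rename ρ′ M) ≡ rename (ρ ∘ ρ′) M
rename-rename ρ ρ′ (var x) = refl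
rename-rename ρ ρ′ (M · N) = cong₂ _·_ (rename-rename ρ ρ′ M) (rename-rename ρ ρ′ N)
rename-rename ρ ρ′ (ƛ M)   = cong ƛ_ (trans (rename-rename (ext ρ) (ext ρ′) M)
                                            (rename-cong (λ { zero → refl ; (suc x) → refl }) M))

rename-subst : ∀ ρ σ M → rename ρ (subst σ M) ≡ subst (rename ρ ∘ σ) M
rename-subst ρ σ (var x) = refl
rename-subst ρ σ (M · N) = cong₂ _·_ (rename-subst ρ σ M) (rename-subst ρ σ N)
rename-subst ρ σ (ƛ M)   = cong ƛ_ (trans (rename-subst (ext ρ) (exts σ) M) (subst-cong M λ
  { zero _ → refl
  ; (suc x) _ → trans (rename-rename (ext ρ) suc (σ x)) (sym (rename-rename suc ρ (σ x))) }))

subst-rename : ∀ σ ρ M → subst σ (rename ρ M) ≡ subst (σ ∘ ρ) M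
subst-rename σ ρ (var x) = refl
subst-rename σ ρ (M · N) = cong₂ _·_ (subst-rename σ ρ M) (subst-rename σ ρ N)
subst-rename σ ρ (ƛ M)   = cong ƛ_ (trans (subst-rename (exts σ) (ext ρ) M)
                                          (subst-cong M λ { zero _ → refl ; (suc x) _ → refl }))

subst-subst : ∀ σ τ M → subst σ (subst τ M) ≡ subst (subst σ ∘ τ) M
subst-subst σ τ (var x) = refl
subst-subst σ τ (M · N) = cong₂ _·_ (subst-subst σ τ M) (subst-subst σ τ N)
subst-subst σ τ (ƛ M)   = cong ƛ_ (trans (subst-subst (exts σ) (exts τ) M) (subst-cong M λ
  { zero _ → refl
  ; (suc x) _ → trans (subst-rename (exts σ) suc (τ x)) (sym (rename-subst suc σ (τ x))) }))

subst-var : ∀ M → subst var M ≡ M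
subst-var (var x) = refl
subst-var (M · N) = cong₂ _·_ (subst-var M) (subst-var N)
subst-var (ƛ M)   = cong ƛ_ (trans (subst-cong M λ { zero _ → refl ; (suc x) _ → refl }) (subst-var M))

rename-as-subst : ∀ ρ M → rename ρ M ≡ subst (var ∘ ρ) M
rename-as-subst ρ (var x) = refl
rename-as-subst ρ (M · N) = cong₂ _·_ (rename-as-subst ρ M) (rename-as-subst ρ N)
rename-as-subst ρ (ƛ M)   = cong ƛ_ (trans (rename-as-subst (ext ρ) M)
                                            (subst-cong M λ { zero _ → refl ; (suc x) _ → refl }))

rename-id : ∀ M → rename id M ≡ M
rename-id M = trans (rename-as-subst id M) (subst-var M)

rename-cong-FV : ∀ {ρ ρ′} M → (∀ x → x FreeIn M → ρ x ≡ ρ′ x) → rename ρ M ≡ rename ρ′ M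
rename-cong-FV {ρ} {ρ′} M h = begin
  rename ρ M             ≡⟨ rename-as-subst ρ M ⟩
  subst (var ∘ ρ) M      ≡⟨ subst-cong M (λ x p → cong var (h x p)) ⟩
  subst (var ∘ ρ′) M     ≡⟨ sym (rename-as-subst ρ′ M) ⟩
  rename ρ′ M            ∎
  where open ≡-Reasoning

[]-as-subst : ∀ M N → M [ N ] ≡ subst (sub₀ N) M
[]-as-subst M N = subst-cong M λ { zero _ → refl ; (suc n) _ → refl }

subst-[] : ∀ σ M N → subst σ (M [ N ]) ≡ subst (exts σ) M [ subst σ N ]
subst-[] σ M N = begin
  subst σ (M [ N ])                              ≡⟨ cong (subst σ) ([]-as-subst M N) ⟩
  subst σ (subst (sub₀ N) M)                     ≡⟨ subst-subst σ (sub₀ N) M ⟩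
  subst (subst σ ∘ sub₀ N) M                     ≡⟨ subst-cong M (λ x _ → commute x) ⟩
  subst (subst (sub₀ (subst σ N)) ∘ exts σ) M    ≡⟨ sym (subst-subst _ (exts σ) M) ⟩
  subst (sub₀ (subst σ N)) (subst (exts σ) M)    ≡⟨ sym ([]-as-subst (subst (exts σ) M) (subst σ N)) ⟩
  subst (exts σ) M [ subst σ N ]                 ∎
  where
  open ≡-Reasoning
  commute : ∀ x → subst σ (sub₀ N x) ≡ subst (sub₀ (subst σ N)) (exts σ x)
  commute zero    = refl
  commute (suc x) = sym (trans (subst-rename (sub₀ (subst σ N)) suc (σ x)) (subst-var (σ x)))

rename-[] : ∀ ρ M N → rename ρ (M [ N ]) ≡ rename (ext ρ) M [ rename ρ N ]
rename-[] ρ M N = begin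
  rename ρ (M [ N ])                                   ≡⟨ rename-as-subst ρ (M [ N ]) ⟩
  subst (var ∘ ρ) (M [ N ])                            ≡⟨ subst-[] (var ∘ ρ) M N ⟩
  subst (exts (var ∘ ρ)) M [ subst (var ∘ ρ) N ]       ≡⟨ cong₂ _[_] exts-var (sym (rename-as-subst ρ N)) ⟩
  rename (ext ρ) M [ rename ρ N ]                      ∎
  where
  open ≡-Reasoning
  exts-var : subst (exts (var ∘ ρ)) M ≡ rename (ext ρ) M
  exts-var = trans (subst-cong M λ { zero _ → refl ; (suc x) _ → refl }) (sym (rename-as-subst (ext ρ) M))

subst-apps : ∀ σ M Ns → subst σ (apps M Ns) ≡ apps (subst σ M) (map (subst σ) Ns)
subst-apps σ M []       = refl
subst-apps σ M (N ∷ Ns) = subst-apps σ (M · N) Ns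

rename-apps : ∀ ρ M Ns → rename ρ (apps M Ns) ≡ apps (rename ρ M) (map (rename ρ) Ns)
rename-apps ρ M []       = refl
rename-apps ρ M (N ∷ Ns) = rename-apps ρ (M · N) Ns

apps-∷ʳ : ∀ M Ns N → apps M (Ns ∷ʳ N) ≡ apps M Ns · N
apps-∷ʳ M []        N = refl
apps-∷ʳ M (N′ ∷ Ns) N = apps-∷ʳ (M · N′) Ns N

rename-apps-∷ʳ : ∀ ρ M Ns N → rename ρ (apps M Ns) · N ≡ apps (rename ρ M) (map (rename ρ) Ns ∷ʳ N)
rename-apps-∷ʳ ρ M Ns N = trans (cong (_· N) (rename-apps ρ M Ns)) (sym (apps-∷ʳ (rename ρ M) (map (rename ρ) Ns) N))

subst-apps-head : ∀ σ {M t} Ns → subst σ M ≡ t → subst σ (apps M Ns) ≡ apps t (map (subst σ) Ns)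
subst-apps-head σ {M} Ns e = trans (subst-apps σ M Ns) (cong (λ P → apps P (map (subst σ) Ns)) e)

subst-redex : ∀ σ M N Ns →
  subst σ (apps (M [ N ]) Ns) ≡ apps (subst (exts σ) M [ subst σ N ]) (map (subst σ) Ns)
subst-redex σ M N Ns = subst-apps-head σ Ns (subst-[] σ M N)

rename-redex : ∀ ρ M N Ns →
  rename ρ (apps (M [ N ]) Ns) ≡ apps (rename (ext ρ) M [ rename ρ N ]) (map (rename ρ) Ns)
rename-redex ρ M N Ns = trans (rename-apps ρ (M [ N ]) Ns) (cong (λ P → apps P (map (rename ρ) Ns)) (rename-[] ρ M N))

bound : Term → ℕ
bound (var x) = suc x
bound (M · N) = bound M ⊔ bound N
bound (ƛ M)   = pred (bound M)

FreeIn⇒<bound : ∀ {x M} → x FreeIn M → x < bound M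
FreeIn⇒<bound fv-var                 = ≤-refl
FreeIn⇒<bound {M = M · N} (fv-l p)   = ≤-trans (FreeIn⇒<bound p) (m≤m⊔n (bound M) (bound N))
FreeIn⇒<bound {M = M · N} (fv-r p)   = ≤-trans (FreeIn⇒<bound p) (m≤n⊔m (bound M) (bound N))
FreeIn⇒<bound (fv-ƛ p)               = pred-mono-≤ (FreeIn⇒<bound p)

boundᴸ : List Term → ℕ
boundᴸ []       = 0
boundᴸ (M ∷ Ms) = bound M ⊔ boundᴸ Ms

boundᶜ : Ctx → ℕ
boundᶜ []            = 0
boundᶜ ((x , _) ∷ Γ) = suc x ⊔ boundᶜ Γ

fresh : ∀ {y} Ms → boundᴸ Ms ≤ y → All (λ M → ¬ (y FreeIn M)) Ms
fresh []       _ = []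
fresh (M ∷ Ms) le =
  (λ p → <⇒≱ (FreeIn⇒<bound p) (≤-trans (m≤m⊔n (bound M) (boundᴸ Ms)) le))
  ∷ fresh Ms (≤-trans (m≤n⊔m (bound M) (boundᴸ Ms)) le)

freshᶜ : ∀ {y} Γ → boundᶜ Γ ≤ y → y ∉ᶜ Γ
freshᶜ ((x , _) ∷ Γ) le _ (here refl) = <⇒≱ (m≤m⊔n (suc x) (boundᶜ Γ)) le
freshᶜ ((x , _) ∷ Γ) le B (there m)   = freshᶜ Γ (≤-trans (m≤n⊔m (suc x) (boundᶜ Γ)) le) B m

∉ᶜ⇒≢ : ∀ {y z T Γ} → y ∉ᶜ Γ → (z , T) ∈ Γ → z ≢ y
∉ᶜ⇒≢ y∉Γ m refl = y∉Γ _ m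

FreeIn⇒≢ : ∀ {y z M} → ¬ (y FreeIn M) → z FreeIn M → z ≢ y
FreeIn⇒≢ y∉M z∈M refl = y∉M z∈M

update : ∀ {X : Set} → (ℕ → X) → ℕ → X → ℕ → X
update f y v z with z ≟ y
... | yes _ = v
... | no  _ = f z

update-≡ : ∀ {X : Set} (f : ℕ → X) y v → update f y v y ≡ v
update-≡ f y v with y ≟ y
... | yes _   = refl
... | no  y≢y = ⊥-elim (y≢y refl)

update-≢ : ∀ {X : Set} (f : ℕ → X) {y} v {z} → z ≢ y → update f y v z ≡ f z
update-≢ f {y} v {z} z≢y with z ≟ y
... | yes z≡y = ⊥-elim (z≢y z≡y)
... | no  _   = refl

subst-spine-update : ∀ σ {y} t Ns → All (λ P → ¬ (y FreeIn P)) Ns →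
  subst (update σ y t) (apps (var y) Ns) ≡ apps t (map (subst σ) Ns)
subst-spine-update σ {y} t Ns fr = begin
  subst (update σ y t) (apps (var y) Ns)                        ≡⟨ subst-apps _ (var y) Ns ⟩
  apps (update σ y t y) (map (subst (update σ y t)) Ns)         ≡⟨ cong₂ apps (update-≡ σ y t) (map-cong-local (All.map agree fr)) ⟩
  apps t (map (subst σ) Ns)                                     ∎
  where
  open ≡-Reasoning
  agree : ∀ {P} → ¬ (y FreeIn P) → subst (update σ y t) P ≡ subst σ P
  agree {P} y∉P = subst-cong P (λ z p → update-≢ σ t (FreeIn⇒≢ y∉P p))

rename-spine-update : ∀ ρ {y} y′ Ns → All (λ P → ¬ (y FreeIn P)) Ns →
  rename (update ρ y y′) (apps (var y) Ns) ≡ apps (var y′) (map (rename ρ) Ns)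
rename-spine-update ρ {y} y′ Ns fr = begin
  rename (update ρ y y′) (apps (var y) Ns)                        ≡⟨ rename-apps _ (var y) Ns ⟩
  apps (var (update ρ y y′ y)) (map (rename (update ρ y y′)) Ns)  ≡⟨ cong₂ apps (cong var (update-≡ ρ y y′)) (map-cong-local (All.map agree fr)) ⟩
  apps (var y′) (map (rename ρ) Ns)                               ∎
  where
  open ≡-Reasoning
  agree : ∀ {P} → ¬ (y FreeIn P) → rename (update ρ y y′) P ≡ rename ρ P
  agree {P} y∉P = rename-cong-FV P (λ z p → update-≢ ρ y′ (FreeIn⇒≢ y∉P p))

≈ᶜ-∷ : ∀ {p Γ} → p ∈ Γ → Γ ≈ᶜ (p ∷ Γ)
≈ᶜ-∷ p∈Γ _ = mk⇔ there λ { (here refl) → p∈Γ ; (there q∈Γ) → q∈Γ }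

≈ᶜ-head : ∀ {Δ p Γ} → Δ ≈ᶜ (p ∷ Γ) → p ∈ Δ
≈ᶜ-head eq = Equivalence.from (eq _) (here refl)

≈ᶜ-tail : ∀ {Δ p Γ} → Δ ≈ᶜ (p ∷ Γ) → Γ ⊆ Δ
≈ᶜ-tail eq q∈Γ = Equivalence.from (eq _) (there q∈Γ)

∈-shift⁺ : ∀ {z T Γ} → (z , T) ∈ Γ → (suc z , T) ∈ shift Γ
∈-shift⁺ = ∈-map⁺ _

∈-shift⁻ : ∀ {z T Γ} → (z , T) ∈ shift Γ → ∃ λ z′ → z ≡ suc z′ × (z′ , T) ∈ Γ
∈-shift⁻ m with ∈-map⁻ _ m
... | (z′ , _) , m′ , refl = z′ , refl , m′

zero∉shift : ∀ Γ → zero ∉ᶜ shift Γ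
zero∉shift Γ _ m with ∈-shift⁻ m
... | _ , () , _

typesOf-sound : ∀ x Γ → All (λ T → (x , T) ∈ Γ) (typesOf x Γ)
typesOf-sound x []            = []
typesOf-sound x ((y , A) ∷ Γ) with x ≟ y
... | yes refl = here refl ∷ All.map there (typesOf-sound x Γ)
... | no  _    = All.map there (typesOf-sound x Γ)

typesOf-≡ : ∀ y A Γ → typesOf y ((y , A) ∷ Γ) ≡ A ∷ typesOf y Γ
typesOf-≡ y A Γ with y ≟ y
... | yes _   = refl
... | no  y≢y = ⊥-elim (y≢y refl)

typesOf-≢ : ∀ {x y} A Γ → x ≢ y → typesOf x ((y , A) ∷ Γ) ≡ typesOf x Γ
typesOf-≢ {x} {y} A Γ x≢y with x ≟ y
... | yes x≡y = ⊥-elim (x≢y x≡y)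
... | no  _   = refl

typesOf-complete : ∀ {x T Γ} → (x , T) ∈ Γ → T ∈ typesOf x Γ
typesOf-complete {x} {T} {_ ∷ Γ} (here refl) rewrite typesOf-≡ x T Γ = here refl
typesOf-complete {x} {T} {(y , _) ∷ Γ} (there m) with x ≟ y
... | yes _ = there (typesOf-complete m)
... | no  _ = typesOf-complete m

typesOf-∉ : ∀ {y Γ} → y ∉ᶜ Γ → typesOf y Γ ≡ []
typesOf-∉ {y} {Γ} y∉Γ with typesOf y Γ | typesOf-sound y Γ
... | []    | _     = refl
... | T ∷ _ | m ∷ _ = ⊥-elim (y∉Γ T m)

typesOf-shift : ∀ z Γ → typesOf (suc z) (shift Γ) ≡ typesOf z Γ
typesOf-shift z []            = refl
typesOf-shift z ((y , B) ∷ Γ) with z ≟ y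
... | yes refl = trans (typesOf-≡ (suc z) B (shift Γ)) (cong (B ∷_) (typesOf-shift z Γ))
... | no  z≢y  = trans (typesOf-≢ B (shift Γ) (z≢y ∘ suc-injective)) (typesOf-shift z Γ)

∩ᶜ-∷-≢ : ∀ {x y} A Γ → x ≢ y → (((y , A) ∷ Γ) ∩ᶜ) x ≡ (Γ ∩ᶜ) x
∩ᶜ-∷-≢ A Γ x≢y = cong ⋂ (typesOf-≢ A Γ x≢y)

∩ᶜ-∷-∉ : ∀ {y} A Γ → y ∉ᶜ Γ → (((y , A) ∷ Γ) ∩ᶜ) y ≡ just A
∩ᶜ-∷-∉ {y} A Γ y∉Γ = cong ⋂ (trans (typesOf-≡ y A Γ) (cong (A ∷_) (typesOf-∉ y∉Γ)))

∩ᶜ-bind : ∀ A Γ z → (((zero , A) ∷ shift Γ) ∩ᶜ) z ≡ (A ▸ (Γ ∩ᶜ)) z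
∩ᶜ-bind A Γ zero    = ∩ᶜ-∷-∉ A (shift Γ) (zero∉shift Γ)
∩ᶜ-bind A Γ (suc z) = trans (∩ᶜ-∷-≢ {y = zero} A (shift Γ) λ ()) (cong ⋂ (typesOf-shift z Γ))

∩ᶜ-intro : ∀ {P : Type → Set} {Γ x B} → (∀ {A A′} → P A → P A′ → P (A ∩ A′)) →
  (∀ {T} → (x , T) ∈ Γ → P T) → (Γ ∩ᶜ) x ≡ just B → P B
∩ᶜ-intro {P} {Γ} {x} ∩-intro PΓ = ⋂-intro (All.map PΓ (typesOf-sound x Γ))
  where
  ⋂-intro : ∀ {Ts B} → All P Ts → ⋂ Ts ≡ just B → P B
  ⋂-intro (p ∷ [])     refl = p
  ⋂-intro (p ∷ q ∷ ps) refl = ∩-intro p (⋂-intro (q ∷ ps) refl)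

-- Λ^s: renaming, inversion of ∩, and cut

cast : ∀ {Γ M M′ A} → M ≡ M′ → Γ ⊢s M ∶ A → Γ ⊢s M′ ∶ A
cast refl D = D

L→-∈ : ∀ {Γ w N A₁ A₂ B} Ns → (w , A₁ ⇒ A₂) ∈ Γ → Γ ⊢s N ∶ A₁ →
  (∀ y → ((y , A₂) ∷ Γ) ⊢s apps (var y) Ns ∶ B) → Γ ⊢s apps (var w · N) Ns ∶ B
L→-∈ {Γ} Ns m DN D =
  L→ {y = y} (≈ᶜ-∷ m) DN (D y) (fresh Ns (m≤n⊔m (boundᶜ Γ) _)) (freshᶜ Γ (m≤m⊔n _ (boundᴸ Ns)))
  where y = boundᶜ Γ ⊔ boundᴸ Ns

L∩-∈ : ∀ {Γ x A₁ A₂ B} Ns → (x , A₁ ∩ A₂) ∈ Γ →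
  ((x , A₁) ∷ (x , A₂) ∷ Γ) ⊢s apps (var x) Ns ∶ B → Γ ⊢s apps (var x) Ns ∶ B
L∩-∈ Ns m = L∩ {Ns = Ns} (≈ᶜ-∷ m)

Renaming : (ℕ → ℕ) → Ctx → Ctx → Set
Renaming ρ Γ Δ = ∀ {z T} → (z , T) ∈ Γ → (ρ z , T) ∈ Δ

Renaming-∷ : ∀ {ρ Γ Δ z T} → Renaming ρ Γ Δ → Renaming ρ ((z , T) ∷ Γ) ((ρ z , T) ∷ Δ)
Renaming-∷ h (here refl) = here refl
Renaming-∷ h (there m)   = there (h m)

Renaming-ext : ∀ {ρ Γ Δ A} → Renaming ρ Γ Δ →
  Renaming (ext ρ) ((zero , A) ∷ shift Γ) ((zero , A) ∷ shift Δ)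
Renaming-ext h (here refl) = here refl
Renaming-ext h (there m) with ∈-shift⁻ m
... | _ , refl , m′ = there (∈-shift⁺ (h m′))

Renaming-update : ∀ {ρ Γ Δ y A} y′ → y ∉ᶜ Γ → Renaming ρ Γ Δ →
  Renaming (update ρ y y′) ((y , A) ∷ Γ) ((y′ , A) ∷ Δ)
Renaming-update {ρ} {y = y} y′ y∉Γ h (here refl) rewrite update-≡ ρ y y′ = here refl
Renaming-update {ρ} y′ y∉Γ h (there m) rewrite update-≢ ρ y′ (∉ᶜ⇒≢ y∉Γ m) = there (h m)

⊢s-rename : ∀ {Γ Δ M A} ρ → Renaming ρ Γ Δ → Γ ⊢s M ∶ A → Δ ⊢s rename ρ M ∶ A
⊢s-rename ρ h (ax m) = ax (h m)
⊢s-rename ρ h (beta {M = M} {N} {Ns} D E) =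
  cast (sym (rename-apps ρ ((ƛ M) · N) Ns))
    (beta {M = rename (ext ρ) M} {N = rename ρ N} {Ns = map (rename ρ) Ns}
      (cast (rename-redex ρ M N Ns) (⊢s-rename ρ h D)) (⊢s-rename ρ h E))
⊢s-rename {Δ = Δ} ρ h (L→ {Γ = Γ} {x} {y} {N} {Ns} eq DN D fr y∉Γ) =
  cast (sym (rename-apps ρ (var x · N) Ns))
    (L→-∈ (map (rename ρ) Ns) (h (≈ᶜ-head eq)) (⊢s-rename ρ h₀ DN) λ y′ →
      cast (rename-spine-update ρ y′ Ns fr) (⊢s-rename (update ρ y y′) (Renaming-update y′ y∉Γ h₀) D))
  where
  h₀ : Renaming ρ Γ Δ
  h₀ m = h (≈ᶜ-tail eq m)
⊢s-rename ρ h (R→ D) = R→ (⊢s-rename (ext ρ) (Renaming-ext h) D)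
⊢s-rename ρ h (L∩ {x = x} {Ns} eq D) =
  cast (sym (rename-apps ρ (var x) Ns))
    (L∩-∈ (map (rename ρ) Ns) (h (≈ᶜ-head eq))
      (cast (rename-apps ρ (var x) Ns) (⊢s-rename ρ (Renaming-∷ (Renaming-∷ λ m → h (≈ᶜ-tail eq m))) D)))
⊢s-rename ρ h (R∩ D E) = R∩ (⊢s-rename ρ h D) (⊢s-rename ρ h E)
⊢s-rename ρ h ω-r      = ω-r

⊢s-weaken : ∀ {Γ Δ M A} → Γ ⊆ Δ → Γ ⊢s M ∶ A → Δ ⊢s M ∶ A
⊢s-weaken {M = M} Γ⊆Δ D = cast (rename-id M) (⊢s-rename id (λ m → Γ⊆Δ m) D)

⊢s-∩⁻ : ∀ {Γ M A B} → Γ ⊢s M ∶ A ∩ B → Γ ⊢s M ∶ A × Γ ⊢s M ∶ B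
⊢s-∩⁻ (ax m) = L∩-∈ [] m (ax (here refl)) , L∩-∈ [] m (ax (there (here refl)))
⊢s-∩⁻ (beta {M = M} {N} {Ns} D E) with ⊢s-∩⁻ D
... | D₁ , D₂ = beta {M = M} {N = N} {Ns = Ns} D₁ E , beta {M = M} {N = N} {Ns = Ns} D₂ E
⊢s-∩⁻ (L→ eq DN D fr y∉Γ) with ⊢s-∩⁻ D
... | D₁ , D₂ = L→ eq DN D₁ fr y∉Γ , L→ eq DN D₂ fr y∉Γ
⊢s-∩⁻ (L∩ {Ns = Ns} eq D) with ⊢s-∩⁻ D
... | D₁ , D₂ = L∩ {Ns = Ns} eq D₁ , L∩ {Ns = Ns} eq D₂
⊢s-∩⁻ (R∩ D E) = D , E

size : Type → ℕ
size (atom _) = 0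
size ω        = 0
size (A ⇒ B)  = suc (size A + size B)
size (A ∩ B)  = suc (size A + size B)

size-left : ∀ {n} A B → suc (size A + size B) ≤ n → size A ≤ n
size-left A B le = ≤-trans (m≤m+n (size A) (size B)) (≤-trans (n≤1+n _) le)

size-right : ∀ {n} A B → suc (size A + size B) ≤ n → size B ≤ n
size-right A B le = ≤-trans (m≤n+m (size B) (size A)) (≤-trans (n≤1+n _) le)

size-left-< : ∀ {n} A B → suc (size A + size B) ≤ suc n → size A ≤ n
size-left-< A B (s≤s le) = ≤-trans (m≤m+n (size A) (size B)) le

data Entry (n : ℕ) (Δ : Ctx) (t : Term) (T : Type) : Set where
  renamed : ∀ {w} → t ≡ var w → (w , T) ∈ Δ → Entry n Δ t T
  typed   : size T ≤ n → Δ ⊢s t ∶ T → Entry n Δ t T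

Substitution : ℕ → (ℕ → Term) → Ctx → Ctx → Set
Substitution n σ Γ Δ = ∀ {z T} → (z , T) ∈ Γ → Entry n Δ (σ z) T

Entry-cast : ∀ {n Δ t t′ T} → t ≡ t′ → Entry n Δ t T → Entry n Δ t′ T
Entry-cast refl e = e

Substitution-∷ : ∀ {n σ Γ Δ z T} → Entry n Δ (σ z) T → Substitution n σ Γ Δ →
  Substitution n σ ((z , T) ∷ Γ) Δ
Substitution-∷ e h (here refl) = e
Substitution-∷ e h (there m)   = h m

Substitution-weaken : ∀ {n σ Γ Δ Δ′} → Δ ⊆ Δ′ → Substitution n σ Γ Δ → Substitution n σ Γ Δ′
Substitution-weaken Δ⊆Δ′ h m with h m
... | renamed e m′ = renamed e (Δ⊆Δ′ m′)
... | typed s D    = typed s (⊢s-weaken Δ⊆Δ′ D)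

Substitution-exts : ∀ {n σ Γ Δ A} → Substitution n σ Γ Δ →
  Substitution n (exts σ) ((zero , A) ∷ shift Γ) ((zero , A) ∷ shift Δ)
Substitution-exts h (here refl) = renamed refl (here refl)
Substitution-exts h (there m) with ∈-shift⁻ m
... | _ , refl , m′ with h m′
...   | renamed e m″ = renamed (cong (rename suc) e) (there (∈-shift⁺ m″))
...   | typed s D    = typed s (⊢s-rename suc (λ k → there (∈-shift⁺ k)) D)

Substitution-update : ∀ {n σ Γ Δ y t T} → y ∉ᶜ Γ → Entry n Δ t T → Substitution n σ Γ Δ →
  Substitution n (update σ y t) ((y , T) ∷ Γ) Δ
Substitution-update {σ = σ} {y = y} {t} y∉Γ e h (here refl) = Entry-cast (sym (update-≡ σ y t)) e
Substitution-update {σ = σ} {t = t} y∉Γ e h (there m) =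
  Entry-cast (sym (update-≢ σ t (∉ᶜ⇒≢ y∉Γ m))) (h m)

-- Stated up to a renaming because, in the (L→) case, the variable y of the
-- second premise must be renamed apart from the new argument N.
Cut : ℕ → Set
Cut n = ∀ {Γ Δ M N A B} ρ → Renaming ρ Γ Δ → size (A ⇒ B) ≤ n →
        Γ ⊢s M ∶ A ⇒ B → Δ ⊢s N ∶ A → Δ ⊢s rename ρ M · N ∶ B

SubstitutionLemma : ℕ → Set
SubstitutionLemma n = ∀ {σ Γ Δ M A} → Substitution n σ Γ Δ → Γ ⊢s M ∶ A → Δ ⊢s subst σ M ∶ A

cut-id : ∀ {n Γ M N A B} → Cut n → size (A ⇒ B) ≤ n →
  Γ ⊢s M ∶ A ⇒ B → Γ ⊢s N ∶ A → Γ ⊢s M · N ∶ B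
cut-id {M = M} cut s DM DN = cast (cong (_· _) (rename-id M)) (cut id (λ m → m) s DM DN)

module _ {n} (cut : Cut n) where

  ⊢s-subst : SubstitutionLemma n

  ⊢s-subst-L∩ : ∀ {σ Δ′ Γ Δ x Ns A₁ A₂ B} → Substitution n σ Δ′ Δ → Δ′ ≈ᶜ ((x , A₁ ∩ A₂) ∷ Γ) →
    Entry n Δ (σ x) (A₁ ∩ A₂) → ((x , A₁) ∷ (x , A₂) ∷ Γ) ⊢s apps (var x) Ns ∶ B →
    Δ ⊢s subst σ (apps (var x) Ns) ∶ B
  ⊢s-subst-L∩ {σ} {Γ = Γ} {Δ} {x} {Ns} {A₁} {A₂} h eq (renamed {w} e m) D =
    cast (sym (subst-apps-head σ Ns e))
      (L∩-∈ (map (subst σ) Ns) m (cast (subst-apps-head σ Ns e) (⊢s-subst h′ D)))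
    where
    h′ : Substitution n σ ((x , A₁) ∷ (x , A₂) ∷ Γ) ((w , A₁) ∷ (w , A₂) ∷ Δ)
    h′ = Substitution-∷ (renamed e (here refl)) (Substitution-∷ (renamed e (there (here refl)))
           (Substitution-weaken (λ k → there (there k)) λ k → h (≈ᶜ-tail eq k)))
  ⊢s-subst-L∩ {A₁ = A₁} {A₂} h eq (typed s Dx) D with ⊢s-∩⁻ Dx
  ... | D₁ , D₂ = ⊢s-subst (Substitution-∷ (typed (size-left A₁ A₂ s) D₁)
                    (Substitution-∷ (typed (size-right A₁ A₂ s) D₂) λ k → h (≈ᶜ-tail eq k))) D

  ⊢s-subst-L→ : ∀ {σ Δ′ Γ Δ x y N Ns A₁ A₂ B} → Substitution n σ Δ′ Δ → Δ′ ≈ᶜ ((x , A₁ ⇒ A₂) ∷ Γ) →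
    Entry n Δ (σ x) (A₁ ⇒ A₂) → Γ ⊢s N ∶ A₁ → ((y , A₂) ∷ Γ) ⊢s apps (var y) Ns ∶ B →
    All (λ P → ¬ (y FreeIn P)) Ns → y ∉ᶜ Γ → Δ ⊢s subst σ (apps (var x · N) Ns) ∶ B
  ⊢s-subst-L→ {σ} {Γ = Γ} {Δ} {N = N} {Ns} h eq (renamed e m) DN D fr y∉Γ =
    cast (sym (subst-apps-head σ Ns (cong (_· subst σ N) e)))
      (L→-∈ (map (subst σ) Ns) m (⊢s-subst h₀ DN) λ y′ →
        cast (subst-spine-update σ (var y′) Ns fr)
          (⊢s-subst (Substitution-update y∉Γ (renamed refl (here refl)) (Substitution-weaken there h₀)) D))
    where
    h₀ : Substitution n σ Γ Δ
    h₀ k = h (≈ᶜ-tail eq k)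
  ⊢s-subst-L→ {σ} {Γ = Γ} {Δ} {x} {N = N} {Ns} {A₁} {A₂} h eq (typed s Dx) DN D fr y∉Γ =
    cast (trans (subst-spine-update σ (σ x · subst σ N) Ns fr) (sym (subst-apps σ (var x · N) Ns)))
      (⊢s-subst (Substitution-update y∉Γ (typed (size-right A₁ A₂ s) Dhead) h₀) D)
    where
    h₀ : Substitution n σ Γ Δ
    h₀ k = h (≈ᶜ-tail eq k)
    Dhead : Δ ⊢s σ x · subst σ N ∶ A₂
    Dhead = cut-id cut s Dx (⊢s-subst h₀ DN)

  ⊢s-subst h (ax m) with h m
  ... | renamed e m′ = cast (sym e) (ax m′)
  ... | typed _ D    = D
  ⊢s-subst {σ} h (beta {M = M} {N} {Ns} D E) =
    cast (sym (subst-apps σ ((ƛ M) · N) Ns))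
      (beta {M = subst (exts σ) M} {N = subst σ N} {Ns = map (subst σ) Ns}
        (cast (subst-redex σ M N Ns) (⊢s-subst h D)) (⊢s-subst h E))
  ⊢s-subst h (L→ eq DN D fr y∉Γ) = ⊢s-subst-L→ h eq (h (≈ᶜ-head eq)) DN D fr y∉Γ
  ⊢s-subst h (R→ D)              = R→ (⊢s-subst (Substitution-exts h) D)
  ⊢s-subst h (L∩ {Ns = Ns} eq D) = ⊢s-subst-L∩ {Ns = Ns} h eq (h (≈ᶜ-head eq)) D
  ⊢s-subst h (R∩ D E)            = R∩ (⊢s-subst h D) (⊢s-subst h E)
  ⊢s-subst h ω-r                 = ω-r

cut-step : ∀ {m} → SubstitutionLemma m → Cut (suc m)
cut-step sub ρ h s (ax m) DN = L→-∈ [] (h m) DN λ _ → ax (here refl)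
cut-step sub {N = N₀} ρ h s (beta {M = M} {N} {Ns} D E) DN₀ =
  cast (sym (rename-apps-∷ʳ ρ ((ƛ M) · N) Ns N₀))
    (beta {M = rename (ext ρ) M} {N = rename ρ N} {Ns = map (rename ρ) Ns ∷ʳ N₀}
      (cast redex (cut-step sub ρ h s D DN₀)) (⊢s-rename ρ h E))
  where
  redex : rename ρ (apps (M [ N ]) Ns) · N₀ ≡ apps (rename (ext ρ) M [ rename ρ N ]) (map (rename ρ) Ns ∷ʳ N₀)
  redex = trans (rename-apps-∷ʳ ρ (M [ N ]) Ns N₀) (cong (λ P → apps P (map (rename ρ) Ns ∷ʳ N₀)) (rename-[] ρ M N))
cut-step sub {Δ = Δ} {N = N₀} ρ h s (L→ {Γ = Γ} {x} {y} {N} {Ns} eq DN D fr y∉Γ) DN₀ =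
  cast (sym (rename-apps-∷ʳ ρ (var x · N) Ns N₀))
    (L→-∈ (map (rename ρ) Ns ∷ʳ N₀) (h (≈ᶜ-head eq)) (⊢s-rename ρ h₀ DN) λ y′ →
      cast (spine y′) (cut-step sub (update ρ y y′) (Renaming-update y′ y∉Γ h₀) s D (⊢s-weaken there DN₀)))
  where
  h₀ : Renaming ρ Γ Δ
  h₀ k = h (≈ᶜ-tail eq k)
  spine : ∀ y′ → rename (update ρ y y′) (apps (var y) Ns) · N₀ ≡ apps (var y′) (map (rename ρ) Ns ∷ʳ N₀)
  spine y′ = trans (cong (_· N₀) (rename-spine-update ρ y′ Ns fr)) (sym (apps-∷ʳ (var y′) (map (rename ρ) Ns) N₀))
cut-step {m} sub {Γ} {Δ} {N = N₀} ρ h s (R→ {M = M} {A} {B} D) DN₀ =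
  beta {M = rename (ext ρ) M} {N = N₀} {Ns = []} (cast redex (sub h₀ D)) DN₀
  where
  h₀ : Substitution m (sub₀ N₀ ∘ ext ρ) ((zero , A) ∷ shift Γ) Δ
  h₀ (here refl) = typed (size-left-< A B s) DN₀
  h₀ (there k) with ∈-shift⁻ k
  ... | _ , refl , k′ = renamed refl (h k′)
  redex : subst (sub₀ N₀ ∘ ext ρ) M ≡ rename (ext ρ) M [ N₀ ]
  redex = sym (trans ([]-as-subst (rename (ext ρ) M) N₀) (subst-rename (sub₀ N₀) (ext ρ) M))
cut-step sub {N = N₀} ρ h s (L∩ {x = x} {Ns} eq D) DN₀ =
  cast (sym (rename-apps-∷ʳ ρ (var x) Ns N₀))
    (L∩-∈ (map (rename ρ) Ns ∷ʳ N₀) (h (≈ᶜ-head eq))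
      (cast (rename-apps-∷ʳ ρ (var x) Ns N₀)
        (cut-step sub ρ (Renaming-∷ (Renaming-∷ λ k → h (≈ᶜ-tail eq k))) s D (⊢s-weaken (λ k → there (there k)) DN₀))))

cut : ∀ n → Cut n
cut zero    _ _ ()
cut (suc n) = cut-step (⊢s-subst (cut n))

-- Λ_∩ω: subject expansion

castω : ∀ {Θ M M′ A} → M ≡ M′ → Θ ⊢ω M ∶ A → Θ ⊢ω M′ ∶ A
castω refl D = D

⊢ω-var-≡ : ∀ {Θ Θ′ x x′ B} → Θ ⊢ω var x ∶ B → Θ x ≡ Θ′ x′ → Θ′ ⊢ω var x′ ∶ B
⊢ω-var-≡ (ax e)   q = ax (trans (sym q) e)
⊢ω-var-≡ (∩I D E) q = ∩I (⊢ω-var-≡ D q) (⊢ω-var-≡ E q)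
⊢ω-var-≡ (∩E₁ D)  q = ∩E₁ (⊢ω-var-≡ D q)
⊢ω-var-≡ (∩E₂ D)  q = ∩E₂ (⊢ω-var-≡ D q)
⊢ω-var-≡ ω-r      q = ω-r

⊢ω-var-replace : ∀ {Θ Θ′ y A C Q} → Θ ⊢ω var y ∶ C → Θ y ≡ just A → Θ′ ⊢ω Q ∶ A → Θ′ ⊢ω Q ∶ C
⊢ω-var-replace (ax e)   e′ DQ with trans (sym e′) e
... | refl = DQ
⊢ω-var-replace (∩I D E) e′ DQ = ∩I (⊢ω-var-replace D e′ DQ) (⊢ω-var-replace E e′ DQ)
⊢ω-var-replace (∩E₁ D)  e′ DQ = ∩E₁ (⊢ω-var-replace D e′ DQ)
⊢ω-var-replace (∩E₂ D)  e′ DQ = ∩E₂ (⊢ω-var-replace D e′ DQ)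
⊢ω-var-replace ω-r      e′ DQ = ω-r

⊢ω-mono : ∀ {Θ Θ′ M A} → Θ ⊢ω M ∶ A →
  (∀ {x B} → x FreeIn M → Θ x ≡ just B → Θ′ ⊢ω var x ∶ B) → Θ′ ⊢ω M ∶ A
⊢ω-mono (ax e) h = h fv-var e
⊢ω-mono {Θ} {Θ′} (→I {M = M} {A = A} D) h = →I (⊢ω-mono D h′)
  where
  h′ : ∀ {x B} → x FreeIn M → (A ▸ Θ) x ≡ just B → (A ▸ Θ′) ⊢ω var x ∶ B
  h′ {zero}  _ e = ax e
  h′ {suc x} p e = ⊢ω-var-≡ (h (fv-ƛ p) e) refl
⊢ω-mono (→E D E) h = →E (⊢ω-mono D (h ∘ fv-l)) (⊢ω-mono E (h ∘ fv-r))
⊢ω-mono (∩I D E) h = ∩I (⊢ω-mono D h) (⊢ω-mono E h)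
⊢ω-mono (∩E₁ D)  h = ∩E₁ (⊢ω-mono D h)
⊢ω-mono (∩E₂ D)  h = ∩E₂ (⊢ω-mono D h)
⊢ω-mono ω-r      h = ω-r

⊢ω-≗ : ∀ {Θ Θ′ M A} → (∀ x → Θ x ≡ Θ′ x) → Θ ⊢ω M ∶ A → Θ′ ⊢ω M ∶ A
⊢ω-≗ q D = ⊢ω-mono D λ {x} _ e → ax (trans (sym (q x)) e)

⊢ω-rename⁻ : ∀ {Θ ρ} M {A} → Θ ⊢ω rename ρ M ∶ A → (Θ ∘ ρ) ⊢ω M ∶ A
⊢ω-rename⁻ (var x) D        = ⊢ω-var-≡ D refl
⊢ω-rename⁻ M       (∩I D E) = ∩I (⊢ω-rename⁻ M D) (⊢ω-rename⁻ M E)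
⊢ω-rename⁻ M       (∩E₁ D)  = ∩E₁ (⊢ω-rename⁻ M D)
⊢ω-rename⁻ M       (∩E₂ D)  = ∩E₂ (⊢ω-rename⁻ M D)
⊢ω-rename⁻ M       ω-r      = ω-r
⊢ω-rename⁻ (M · N) (→E D E) = →E (⊢ω-rename⁻ M D) (⊢ω-rename⁻ N E)
⊢ω-rename⁻ (ƛ M)   (→I D)   = →I (⊢ω-≗ (λ { zero → refl ; (suc x) → refl }) (⊢ω-rename⁻ M D))

-- θ x intersects the types at which σ x is used in a typing of subst σ M.
record SubstTyping (Θ : FCtx) (σ : ℕ → Term) (M : Term) (A : Type) : Set where
  constructor factor
  field
    θ      : ℕ → Type
    typing : (just ∘ θ) ⊢ω M ∶ A
    args   : ∀ x → Θ ⊢ω σ x ∶ θ x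

SubstTyping-merge : ∀ {Θ σ M N P A B C} → (∀ {Θ′} → Θ′ ⊢ω M ∶ A → Θ′ ⊢ω N ∶ B → Θ′ ⊢ω P ∶ C) →
  SubstTyping Θ σ M A → SubstTyping Θ σ N B → SubstTyping Θ σ P C
SubstTyping-merge rule (factor θ₁ D₁ args₁) (factor θ₂ D₂ args₂) =
  factor (λ x → θ₁ x ∩ θ₂ x)
    (rule (⊢ω-mono D₁ λ { _ refl → ∩E₁ (ax refl) }) (⊢ω-mono D₂ λ { _ refl → ∩E₂ (ax refl) }))
    (λ x → ∩I (args₁ x) (args₂ x))

⊢ω-subst⁻ : ∀ {Θ} σ M {A} → Θ ⊢ω subst σ M ∶ A → SubstTyping Θ σ M A
⊢ω-subst⁻ {Θ} σ (var x) {A} D = factor (update (λ _ → ω) x A) (ax (cong just (update-≡ _ x A))) arg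
  where
  arg : ∀ z → Θ ⊢ω σ z ∶ update (λ _ → ω) x A z
  arg z with z ≟ x
  ... | yes refl = D
  ... | no  _    = ω-r
⊢ω-subst⁻ σ M       (∩I D E) = SubstTyping-merge ∩I (⊢ω-subst⁻ σ M D) (⊢ω-subst⁻ σ M E)
⊢ω-subst⁻ σ M       (∩E₁ D)  = let factor θ D′ args = ⊢ω-subst⁻ σ M D in factor θ (∩E₁ D′) args
⊢ω-subst⁻ σ M       (∩E₂ D)  = let factor θ D′ args = ⊢ω-subst⁻ σ M D in factor θ (∩E₂ D′) args
⊢ω-subst⁻ σ M       ω-r      = factor (λ _ → ω) ω-r (λ _ → ω-r)
⊢ω-subst⁻ σ (M · N) (→E D E) = SubstTyping-merge →E (⊢ω-subst⁻ σ M D) (⊢ω-subst⁻ σ N E)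
⊢ω-subst⁻ σ (ƛ M)   (→I {A = A} D) with ⊢ω-subst⁻ (exts σ) M D
... | factor θ D′ args = factor (θ ∘ suc) (→I (⊢ω-mono D′ bound-var)) (λ x → ⊢ω-rename⁻ (σ x) (args (suc x)))
  where
  bound-var : ∀ {x C} → x FreeIn M → just (θ x) ≡ just C → (A ▸ (just ∘ θ ∘ suc)) ⊢ω var x ∶ C
  bound-var {zero}  _ refl = ⊢ω-var-≡ (args zero) refl
  bound-var {suc x} _ refl = ax refl

⊢ω-expand₀ : ∀ {Θ M N A} → Θ ⊢ω M [ N ] ∶ A → Θ ⊢ω (ƛ M) · N ∶ A
⊢ω-expand₀ {Θ} {M} {N} D with ⊢ω-subst⁻ (sub₀ N) M (castω ([]-as-subst M N) D)
... | factor θ D′ args = →E (→I (⊢ω-mono D′ bound-var)) (args zero)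
  where
  bound-var : ∀ {x C} → x FreeIn M → just (θ x) ≡ just C → (θ zero ▸ Θ) ⊢ω var x ∶ C
  bound-var {zero}  _ refl = ax refl
  bound-var {suc x} _ refl = ⊢ω-var-≡ (args (suc x)) refl

Transfer : FCtx → FCtx → Term → Term → Set
Transfer Θ Θ′ P Q = ∀ {C} → Θ ⊢ω P ∶ C → Θ′ ⊢ω Q ∶ C

Transfer-apps : ∀ {Θ Θ′ P Q} Ns → Transfer Θ Θ′ P Q → All (λ N → Transfer Θ Θ′ N N) Ns →
  Transfer Θ Θ′ (apps P Ns) (apps Q Ns)
Transfer-apps []       head []           = head
Transfer-apps (N ∷ Ns) head (arg ∷ args) = Transfer-apps Ns head·arg args
  where
  head·arg : Transfer _ _ (_ · N) (_ · N)
  head·arg (→E D E) = →E (head D) (arg E)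
  head·arg (∩I D E) = ∩I (head·arg D) (head·arg E)
  head·arg (∩E₁ D)  = ∩E₁ (head·arg D)
  head·arg (∩E₂ D)  = ∩E₂ (head·arg D)
  head·arg ω-r      = ω-r

⊢ω-expand : ∀ {Θ M N A} Ns → Θ ⊢ω apps (M [ N ]) Ns ∶ A → Θ ⊢ω apps ((ƛ M) · N) Ns ∶ A
⊢ω-expand Ns = Transfer-apps Ns ⊢ω-expand₀ (All.tabulate λ _ D → D)

∩ᶜ-ax : ∀ {Γ x T} → (x , T) ∈ Γ → (Γ ∩ᶜ) ⊢ω var x ∶ T
∩ᶜ-ax {Γ} {x} {T} m = ⋂-elim (typesOf x Γ) refl (typesOf-complete m)
  where
  ⋂⁺-elim : ∀ {A} As → (Γ ∩ᶜ) ⊢ω var x ∶ ⋂⁺ A As → T ∈ A ∷ As → (Γ ∩ᶜ) ⊢ω var x ∶ T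
  ⋂⁺-elim []       D (here refl) = D
  ⋂⁺-elim (_ ∷ _)  D (here refl) = ∩E₁ D
  ⋂⁺-elim (_ ∷ As) D (there k)   = ⋂⁺-elim As (∩E₂ D) k
  ⋂-elim : ∀ Ts → (Γ ∩ᶜ) x ≡ ⋂ Ts → T ∈ Ts → (Γ ∩ᶜ) ⊢ω var x ∶ T
  ⋂-elim (_ ∷ As) e k = ⋂⁺-elim As (ax e) k

⊢s⇒⊢ω : ∀ {Γ M A} → Γ ⊢s M ∶ A → (Γ ∩ᶜ) ⊢ω M ∶ A
⊢s⇒⊢ω (ax m) = ∩ᶜ-ax m
⊢s⇒⊢ω (beta {M = M} {N} {Ns} D _) = ⊢ω-expand {M = M} {N = N} Ns (⊢s⇒⊢ω D)
⊢s⇒⊢ω {Δ} (L→ {Γ = Γ} {x} {y} {N} {Ns} {A₁} {A₂} eq DN D fr y∉Γ) =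
  Transfer-apps Ns (λ Dy → ⊢ω-var-replace Dy (∩ᶜ-∷-∉ A₂ Γ y∉Γ) head) (All.map argument fr) (⊢s⇒⊢ω D)
  where
  from-Γ : ∀ {z B} → (Γ ∩ᶜ) z ≡ just B → (Δ ∩ᶜ) ⊢ω var z ∶ B
  from-Γ = ∩ᶜ-intro ∩I (λ m → ∩ᶜ-ax (≈ᶜ-tail eq m))
  head : (Δ ∩ᶜ) ⊢ω var x · N ∶ A₂
  head = →E (∩ᶜ-ax (≈ᶜ-head eq)) (⊢ω-mono (⊢s⇒⊢ω DN) λ _ → from-Γ)
  argument : ∀ {P} → ¬ (y FreeIn P) → Transfer (((y , A₂) ∷ Γ) ∩ᶜ) (Δ ∩ᶜ) P P
  argument y∉P D′ = ⊢ω-mono D′ λ p e → from-Γ (trans (sym (∩ᶜ-∷-≢ A₂ Γ (FreeIn⇒≢ y∉P p))) e)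
⊢s⇒⊢ω {Γ} (R→ {A = A} D) = →I (⊢ω-≗ (∩ᶜ-bind A Γ) (⊢s⇒⊢ω D))
⊢s⇒⊢ω {Δ} (L∩ {Γ = Γ} {x} {A₁ = A₁} {A₂} eq D) = ⊢ω-mono (⊢s⇒⊢ω D) λ _ → ∩ᶜ-intro ∩I premise
  where
  premise : ∀ {z T} → (z , T) ∈ ((x , A₁) ∷ (x , A₂) ∷ Γ) → (Δ ∩ᶜ) ⊢ω var z ∶ T
  premise (here refl)         = ∩E₁ (∩ᶜ-ax (≈ᶜ-head eq))
  premise (there (here refl)) = ∩E₂ (∩ᶜ-ax (≈ᶜ-head eq))
  premise (there (there m))   = ∩ᶜ-ax (≈ᶜ-tail eq m)
⊢s⇒⊢ω (R∩ D E) = ∩I (⊢s⇒⊢ω D) (⊢s⇒⊢ω E)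
⊢s⇒⊢ω ω-r      = ω-r

⊢ω⇒⊢s : ∀ {Θ Γ M A} → Θ ⊢ω M ∶ A → (∀ {x B} → Θ x ≡ just B → Γ ⊢s var x ∶ B) → Γ ⊢s M ∶ A
⊢ω⇒⊢s (ax e) h = h e
⊢ω⇒⊢s {Θ} {Γ} (→I {A = A} D) h = R→ (⊢ω⇒⊢s D h′)
  where
  h′ : ∀ {x B} → (A ▸ Θ) x ≡ just B → ((zero , A) ∷ shift Γ) ⊢s var x ∶ B
  h′ {zero}  refl = ax (here refl)
  h′ {suc x} e    = ⊢s-rename suc (λ m → there (∈-shift⁺ m)) (h e)
⊢ω⇒⊢s (→E {A = A} {B} D E) h = cut-id (cut (size (A ⇒ B))) ≤-refl (⊢ω⇒⊢s D h) (⊢ω⇒⊢s E h)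
⊢ω⇒⊢s (∩I D E) h = R∩ (⊢ω⇒⊢s D h) (⊢ω⇒⊢s E h)
⊢ω⇒⊢s (∩E₁ D)  h = proj₁ (⊢s-∩⁻ (⊢ω⇒⊢s D h))
⊢ω⇒⊢s (∩E₂ D)  h = proj₂ (⊢s-∩⁻ (⊢ω⇒⊢s D h))
⊢ω⇒⊢s ω-r      h = ω-r

∩ᶜ⇒⊢s : ∀ {Γ x B} → (Γ ∩ᶜ) x ≡ just B → Γ ⊢s var x ∶ B
∩ᶜ⇒⊢s {Γ} {x} = ∩ᶜ-intro {P = λ B → Γ ⊢s var x ∶ B} R∩ ax

⊢s⇒⊢ℓ : ∀ {Γ M A} → Γ ⊢s M ∶ A → Γ ⊢ℓ M ∶ A
⊢s⇒⊢ℓ (ax m)                      = ax m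
⊢s⇒⊢ℓ (beta {M = M} {N} {Ns} D _) = beta {M = M} {N = N} {Ns = Ns} (⊢s⇒⊢ℓ D)
⊢s⇒⊢ℓ (L→ eq DN D fr y∉Γ)         = L→ eq (⊢s⇒⊢ℓ DN) (⊢s⇒⊢ℓ D) fr y∉Γ
⊢s⇒⊢ℓ (R→ D)                      = R→ (⊢s⇒⊢ℓ D)
⊢s⇒⊢ℓ (L∩ {Ns = Ns} eq D)         = L∩ {Ns = Ns} eq (⊢s⇒⊢ℓ D)
⊢s⇒⊢ℓ (R∩ D E)                    = R∩ (⊢s⇒⊢ℓ D) (⊢s⇒⊢ℓ E)
⊢s⇒⊢ℓ ω-r                         = ω-r

⊢ℓ⇒⊢s : ∀ {Γ M A} → Γ ⊢ℓ M ∶ A → Γ ⊢s M ∶ A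
⊢ℓ⇒⊢s (ax m)                    = ax m
⊢ℓ⇒⊢s (beta {M = M} {N} {Ns} D) = beta {M = M} {N = N} {Ns = Ns} (⊢ℓ⇒⊢s D) ω-r
⊢ℓ⇒⊢s (L→ eq DN D fr y∉Γ)       = L→ eq (⊢ℓ⇒⊢s DN) (⊢ℓ⇒⊢s D) fr y∉Γ
⊢ℓ⇒⊢s (R→ D)                    = R→ (⊢ℓ⇒⊢s D)
⊢ℓ⇒⊢s (L∩ {Ns = Ns} eq D)       = L∩ {Ns = Ns} eq (⊢ℓ⇒⊢s D)
⊢ℓ⇒⊢s (R∩ D E)                  = R∩ (⊢ℓ⇒⊢s D) (⊢ℓ⇒⊢s E)
⊢ℓ⇒⊢s ω-r                       = ω-r

theorem8 : ∀ (Γ : Ctx) (M : Term) (A : Type) →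
    ((Γ ∩ᶜ) ⊢ω M ∶ A ⇔ Γ ⊢s M ∶ A) × (Γ ⊢s M ∶ A ⇔ Γ ⊢ℓ M ∶ A)
theorem8 Γ M A = mk⇔ (λ D → ⊢ω⇒⊢s D ∩ᶜ⇒⊢s) ⊢s⇒⊢ω , mk⇔ ⊢s⇒⊢ℓ ⊢ℓ⇒⊢s
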